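{- Let $(a,b)$ be a digraphic list of length $n$ with $b$ nondecreasing, and let $\tau$ be the transposition of indices $i<j$ where $a_i<a_j$ (so that the permuted list $a_\tau$ satisfies $(a_\tau)_i>(a_\tau)_j$). Then $(a_\tau,b)$ is a digraphic list and $N_2(a_\tau,b)\ge N_2(a,b)$.
   Context: $(a,b)$ denotes $((a_1,b_1),\dots,(a_n,b_n))$ with nonnegative integers; $a_\tau$ is $a$ with entries at positions $i$ and $j$ swapped. A digraph realization is a digraph without loops and without multiple arcs on labeled vertices $v_1,\dots,v_n$ with indegree $a_i$ and outdegree $b_i$ at $v_i$; $(a,b)$ is digraphic if one exists and $N_2(a,b)$ is the number of them. -}

module Defs where

open import Data.Nat using (ℕ; zero; suc; _≤_; _<_; _+_)
open import Data.Bool using (Bool; true; false; if_then_else_)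
open import Data.Fin using (Fin; _≟_)
open import Data.Product using (Σ; _×_; _,_)
open import Data.List using (List; []; _∷_; concatMap; length; filterᵇ)
open import Data.Vec.Functional using (Vector)
open import Relation.Nullary using (does)
open import Relation.Binary.PropositionalEquality using (_≡_)

-- A (labeled) digraph on vertices Fin n, as an adjacency relation:
-- arc v → w  iff  G v w ≡ true.  Simple digraph: no arc v → v (no loops);
-- multiple arcs are excluded since the relation is Bool-valued.
Digraph : ℕ → Set
Digraph n = Fin n → Fin n → Bool

Loopless : ∀ {n} → Digraph n → Set
Loopless {n} G = (v : Fin n) → G v v ≡ false

countFin : ∀ {n} → (Fin n → Bool) → ℕ
countFin {zero}  f = 0
countFin {suc n} f = (if f Fin.zero then 1 else 0) + countFin (λ k → f (Fin.suc k))

indeg : ∀ {n} → Digraph n → Fin n → ℕ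
indeg G v = countFin (λ u → G u v)

outdeg : ∀ {n} → Digraph n → Fin n → ℕ
outdeg G v = countFin (λ w → G v w)

Realizes : ∀ {n} → Vector ℕ n → Vector ℕ n → Digraph n → Set
Realizes {n} a b G = Loopless G × ((v : Fin n) → indeg G v ≡ a v × outdeg G v ≡ b v)

Digraphic : ∀ {n} → Vector ℕ n → Vector ℕ n → Set
Digraphic {n} a b = Σ (Digraph n) (Realizes a b)

allBoolFuns : (n : ℕ) → List (Fin n → Bool)
allBoolFuns zero = (λ ()) ∷ []
allBoolFuns (suc n) =
  concatMap (λ f → (λ { Fin.zero → false ; (Fin.suc k) → f k })
                 ∷ (λ { Fin.zero → true ; (Fin.suc k) → f k }) ∷ [])
            (allBoolFuns n)

allMatrices : (m n : ℕ) → List (Fin m → Fin n → Bool)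
allMatrices zero n = (λ ()) ∷ []
allMatrices (suc m) n =
  concatMap (λ r → Data.List.map (λ G → λ { Fin.zero → r ; (Fin.suc k) → G k })
                                 (allMatrices m n))
            (allBoolFuns n)

allᵇ : ∀ {A : Set} → (A → Bool) → List A → Bool
allᵇ p [] = true
allᵇ p (x ∷ xs) = p x Data.Bool.∧ allᵇ p xs

realizesᵇ : ∀ {n} → Vector ℕ n → Vector ℕ n → Digraph n → Bool
realizesᵇ {n} a b G =
  allᵇ (λ v → Data.Bool.not (G v v)
                        Data.Bool.∧ does (Data.Nat._≟_ (indeg G v) (a v))
                        Data.Bool.∧ does (Data.Nat._≟_ (outdeg G v) (b v)))
                (Data.List.allFin n)

N₂ : ∀ {n} → Vector ℕ n → Vector ℕ n → ℕ
N₂ {n} a b = length (filterᵇ (realizesᵇ a b) (allMatrices n n))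

Nondecreasing : ∀ {n} → Vector ℕ n → Set
Nondecreasing {n} b = (k l : Fin n) → k Data.Fin.≤ l → b k ≤ b l

swapAt : ∀ {n} → Fin n → Fin n → Vector ℕ n → Vector ℕ n
swapAt i j a k =
  if does (k ≟ i) then a j else (if does (k ≟ j) then a i else a k)

module Submission where

-- Let O be the vertices other than i and j, E ⊆ O the columns on which the rows of i and j
-- differ, and D ⊆ O the rows on which the columns of i and j differ. Exchanging the columns of
-- i and j on D swaps the in-degrees of i and j up to the arcs between i and j, and keeps every
-- out-degree; this is all that is needed when G has both or neither of the arcs i → j, j → i.
-- If G has only i → j, the arc is reversed and one arc j → c with c ∈ E is replaced by i → c,
-- which b_i ≤ b_j allows. If G has only j → i, either the arc is reversed and one arc i → c is
-- replaced by j → c, or it is kept and one arc fewer is exchanged on D, which a_i < a_j allows.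
-- The entry that changes is chosen by bracket matching, so that each case is invertible and the
-- case is visible in the image: the resulting map is injective, whence N₂(a,b) ≤ N₂(a_τ,b).

open import Defs
open import Axiom.UniquenessOfIdentityProofs using (module Decidable⇒UIP)
open import Data.Bool as Bool using (Bool; true; false; T; not; _∧_; _xor_; if_then_else_)
open import Data.Bool.Properties
  using (T-∧; T-not-≡; ∧-assoc; ∧-comm; ∧-conicalˡ; ∧-identityʳ; xor-inverseʳ; not-injective; not-involutive)
open import Data.Empty using (⊥-elim)
open import Data.Fin using (Fin; zero; suc; _≟_)
import Data.Fin.Properties as Finₚ
open import Data.List using (List; []; _∷_; length; map; concatMap; filterᵇ; allFin)
open import Data.List.Membership.Propositional.Properties using (∈-allFin)
import Data.List.Membership.Setoid as Membership
import Data.List.Membership.Setoid.Properties as Membershipₚ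
open import Data.List.Properties using (length-map; length-removeAt′)
open import Data.List.Relation.Unary.All as All using (All; []; _∷_)
import Data.List.Relation.Unary.All.Properties as Allₚ
open import Data.List.Relation.Unary.AllPairs using (AllPairs; []; _∷_)
import Data.List.Relation.Unary.AllPairs.Properties as AllPairsₚ
open import Data.List.Relation.Unary.Any as Any using (here; there; _─_; index)
open import Data.List.Relation.Unary.Unique.Setoid using (Unique)
import Data.List.Relation.Unary.Unique.Setoid.Properties as Uniqueₚ
open import Data.Nat using (ℕ; zero; suc; _+_; _≤_; _<_; _≥_; z≤n; s≤s)
import Data.Nat as ℕ
open import Data.Nat.Properties
  using ( +-commutativeSemigroup; +-assoc; +-identityʳ; +-suc; +-cancelʳ-≤; +-cancelʳ-<; suc-injective
        ; ≤-trans; ≤-reflexive; <-trans; <⇒≤; n≤1+n; n<1+n; n≮n; ≡ᵇ⇒≡; ≡⇒≡ᵇ; module ≤-Reasoning )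
open import Algebra.Properties.CommutativeSemigroup +-commutativeSemigroup using (x∙yz≈y∙xz)
open import Data.Product using (Σ; _×_; _,_; proj₁; proj₂)
open import Data.Vec.Functional using (Vector; head; tail) renaming (_∷_ to _◂_)
import Data.Vec.Functional.Relation.Binary.Equality.Setoid as VecEquality
open import Function using (_∘_; Equivalence)
open import Level using (Level)
open import Relation.Binary.Bundles using (Setoid)
open import Relation.Binary.Core using (_Preserves_⟶_)
open import Relation.Binary.PropositionalEquality as ≡
  using (_≡_; _≢_; _≗_; refl; sym; trans; cong; cong₂; subst; module ≡-Reasoning)
open import Relation.Nullary using (¬_; does; yes; no; contradiction)
open import Relation.Nullary.Decidable using (T?; dec-true; dec-false)

if-true : ∀ {A : Set} {b} {x y : A} → b ≡ true → (if b then x else y) ≡ x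
if-true refl = refl

if-false : ∀ {A : Set} {b} {x y : A} → b ≡ false → (if b then x else y) ≡ y
if-false refl = refl

⟦_⟧ : Bool → ℕ
⟦ x ⟧ = if x then 1 else 0

⟦x⟧+⟦not-x⟧ : ∀ x → ⟦ x ⟧ + ⟦ not x ⟧ ≡ 1
⟦x⟧+⟦not-x⟧ true = refl
⟦x⟧+⟦not-x⟧ false = refl

countFin-point : ∀ {n} (f : Vector Bool n) p → countFin f ≡ ⟦ f p ⟧ + countFin (λ k → not (does (k ≟ p)) ∧ f k)
countFin-point {suc n} f zero = refl
countFin-point {suc n} f (suc p) = begin
  ⟦ f zero ⟧ + countFin (tail f)
    ≡⟨ cong (⟦ f zero ⟧ +_) (countFin-point (tail f) p) ⟩
  ⟦ f zero ⟧ + (⟦ f (suc p) ⟧ + countFin (λ k → not (does (k ≟ p)) ∧ f (suc k)))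
    ≡⟨ x∙yz≈y∙xz ⟦ f zero ⟧ ⟦ f (suc p) ⟧ _ ⟩
  ⟦ f (suc p) ⟧ + (⟦ f zero ⟧ + countFin (λ k → not (does (k ≟ p)) ∧ f (suc k))) ∎
  where open ≡-Reasoning

countFin-split : ∀ {n} (m f : Vector Bool n) →
  countFin f ≡ countFin (λ k → m k ∧ f k) + countFin (λ k → not (m k) ∧ f k)
countFin-split {zero} m f = refl
countFin-split {suc n} m f with head m | head f
... | true | true = cong suc (countFin-split (tail m) (tail f))
... | true | false = countFin-split (tail m) (tail f)
... | false | true = trans (cong suc (countFin-split (tail m) (tail f))) (sym (+-suc _ _))
... | false | false = countFin-split (tail m) (tail f)

countFin-cong : ∀ {n} {f g : Vector Bool n} → f ≗ g → countFin f ≡ countFin g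
countFin-cong {zero} f≗g = refl
countFin-cong {suc n} f≗g = cong₂ _+_ (cong ⟦_⟧ (f≗g zero)) (countFin-cong (f≗g ∘ suc))

-- Counting by an injection

private variable
  c ℓ c′ ℓ′ : Level

module _ (S : Setoid c ℓ) where
  open Setoid S using (_≈_)
  open Membership S using (_∈_)

  ∈-─⁺ : ∀ {x y ys} (x∈ys : x ∈ ys) → y ∈ ys → ¬ x ≈ y → y ∈ (ys ─ x∈ys)
  ∈-─⁺ (here x≈) (here y≈) x≉y = ⊥-elim (x≉y (Setoid.trans S x≈ (Setoid.sym S y≈)))
  ∈-─⁺ (here _) (there y∈) _ = y∈
  ∈-─⁺ (there _) (here y≈) _ = here y≈
  ∈-─⁺ (there x∈) (there y∈) x≉y = there (∈-─⁺ x∈ y∈ x≉y)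

  unique⇒length≤ : ∀ {xs ys} → Unique S xs → All (_∈ ys) xs → length xs ≤ length ys
  unique⇒length≤ [] [] = z≤n
  unique⇒length≤ {xs = x ∷ xs} {ys} (x≉xs ∷ xs!) (x∈ys ∷ xs⊆ys) = begin
    suc (length xs)          ≤⟨ s≤s (unique⇒length≤ xs! xs⊆ys─x) ⟩
    suc (length (ys ─ x∈ys)) ≡⟨ length-removeAt′ ys (index x∈ys) ⟨
    length ys                ∎
    where
    open ≤-Reasoning
    xs⊆ys─x : All (_∈ (ys ─ x∈ys)) xs
    xs⊆ys─x = All.zipWith (λ (x≉y , y∈ys) → ∈-─⁺ x∈ys y∈ys x≉y) (x≉xs , xs⊆ys)

  module _ {xs : List (Setoid.Carrier S)} (xs-complete : ∀ x → x ∈ xs) (xs! : Unique S xs)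
           {p q : Setoid.Carrier S → Bool} (q-resp : ∀ {x y} → x ≈ y → T (q x) → T (q y))
           (φ : Setoid.Carrier S → Setoid.Carrier S) (φ-sound : ∀ {x} → T (p x) → T (q (φ x)))
           (φ-injective : ∀ {x y} → T (p x) → T (p y) → φ x ≈ φ y → x ≈ y) where

    length-filterᵇ-≤ : length (filterᵇ p xs) ≤ length (filterᵇ q xs)
    length-filterᵇ-≤ = begin
      length (filterᵇ p xs)         ≡⟨ length-map φ (filterᵇ p xs) ⟨
      length (map φ (filterᵇ p xs)) ≤⟨ unique⇒length≤ (AllPairsₚ.map⁺ (injective p-holds p!)) image⊆ ⟩
      length (filterᵇ q xs)         ∎
      where
      open ≤-Reasoning
      p-holds : All (T ∘ p) (filterᵇ p xs)
      p-holds = Allₚ.all-filter (T? ∘ p) xs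
      p! : Unique S (filterᵇ p xs)
      p! = Uniqueₚ.filter⁺ S (T? ∘ p) xs!
      injective : ∀ {ys} → All (T ∘ p) ys → Unique S ys → AllPairs (λ x y → ¬ φ x ≈ φ y) ys
      injective [] [] = []
      injective (px ∷ pys) (x≉ys ∷ ys!) =
        All.zipWith (λ (py , x≉y) φx≈φy → x≉y (φ-injective px py φx≈φy)) (pys , x≉ys) ∷ injective pys ys!
      image⊆ : All (_∈ filterᵇ q xs) (map φ (filterᵇ p xs))
      image⊆ = Allₚ.map⁺ (All.map (λ {x} px → Membershipₚ.∈-filter⁺ S (T? ∘ q) q-resp (xs-complete (φ x)) (φ-sound px)) p-holds)

module _ (S : Setoid c ℓ) (U : Setoid c′ ℓ′) where
  open Setoid S using () renaming (Carrier to A; _≈_ to _≈₁_)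
  open Setoid U using () renaming (Carrier to B; _≈_ to _≈₂_)

  unique-concatMap : (f : A → List B) (π : B → A) → π Preserves _≈₂_ ⟶ _≈₁_ →
    (∀ x → All (λ y → π y ≈₁ x) (f x)) → (∀ x → Unique U (f x)) →
    ∀ {xs} → Unique S xs → Unique U (concatMap f xs)
  unique-concatMap f π π-cong π∘f f! [] = []
  unique-concatMap f π π-cong π∘f f! {x ∷ xs} (x≉xs ∷ xs!) =
    AllPairsₚ.++⁺ (f! x) (unique-concatMap f π π-cong π∘f f! xs!)
      (All.map (λ πy≈x → All.map (λ πz≉x y≈z → πz≉x (Setoid.trans S (Setoid.sym S (π-cong y≈z)) πy≈x)) others) (π∘f x))
    where
    others : All (λ z → ¬ π z ≈₁ x) (concatMap f xs)
    others = Allₚ.concat⁺ (Allₚ.map⁺ (All.map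
      (λ {x′} x≉x′ → All.map (λ πz≈x′ πz≈x → x≉x′ (Setoid.trans S (Setoid.sym S πz≈x) πz≈x′)) (π∘f x′)) x≉xs))

-- Without function extensionality, vectors and matrices are compared pointwise, so the
-- enumerations are complete and duplicate-free up to that equality.
BoolVec : ℕ → Setoid _ _
BoolVec = VecEquality.≋-setoid (≡.setoid Bool)

BoolMatrix : ℕ → ℕ → Setoid _ _
BoolMatrix m n = VecEquality.≋-setoid (BoolVec n) m

module _ {n : ℕ} where
  open Membership (BoolVec (suc n)) using (_∈_)

  ∈-by-head : ∀ {f h₀ h₁ : Vector Bool (suc n)} →
    (head f ≡ false → f ≗ h₀) → (head f ≡ true → f ≗ h₁) → f ∈ (h₀ ∷ h₁ ∷ [])
  ∈-by-head {f} f≗h₀ f≗h₁ with head f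
  ... | false = here (f≗h₀ refl)
  ... | true = there (here (f≗h₁ refl))

allBoolFuns-complete : ∀ n (f : Vector Bool n) → Membership._∈_ (BoolVec n) f (allBoolFuns n)
allBoolFuns-complete zero f = here (λ ())
allBoolFuns-complete (suc n) f =
  Membershipₚ.∈-concatMap⁺ (BoolVec n) (BoolVec (suc n))
    (Any.map (λ tail≈g → ∈-by-head (λ eq → λ { zero → eq ; (suc k) → tail≈g k })
                                   (λ eq → λ { zero → eq ; (suc k) → tail≈g k }))
             (allBoolFuns-complete n (tail f)))

allBoolFuns-unique : ∀ n → Unique (BoolVec n) (allBoolFuns n)
allBoolFuns-unique zero = [] ∷ []
allBoolFuns-unique (suc n) =
  unique-concatMap (BoolVec n) (BoolVec (suc n)) _ tail (_∘ suc)
    (λ g → (λ _ → refl) ∷ (λ _ → refl) ∷ [])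
    (λ g → ((λ f≗g → contradiction (f≗g zero) λ ()) ∷ []) ∷ [] ∷ [])
    (allBoolFuns-unique n)

allMatrices-complete : ∀ m n (G : Vector (Vector Bool n) m) → Membership._∈_ (BoolMatrix m n) G (allMatrices m n)
allMatrices-complete zero n G = here (λ ())
allMatrices-complete (suc m) n G =
  Membershipₚ.∈-concatMap⁺ (BoolVec n) (BoolMatrix (suc m) n)
    (Any.map (λ head≈r → Membershipₚ.∈-resp-≈ (BoolMatrix (suc m) n)
                            (λ { zero → ≡.sym ∘ head≈r ; (suc k) → λ _ → refl })
                            (Membershipₚ.∈-map⁺ (BoolMatrix m n) (BoolMatrix (suc m) n)
                               (λ G≈H → λ { zero _ → refl ; (suc k) → G≈H k })
                               (allMatrices-complete m n (tail G))))
             (allBoolFuns-complete n (head G)))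

allMatrices-unique : ∀ m n → Unique (BoolMatrix m n) (allMatrices m n)
allMatrices-unique zero n = [] ∷ []
allMatrices-unique (suc m) n =
  unique-concatMap (BoolVec n) (BoolMatrix (suc m) n) _ head (λ G≈H → G≈H zero)
    (λ r → Allₚ.map⁺ (All.universal (λ _ _ → refl) (allMatrices m n)))
    (λ r → Uniqueₚ.map⁺ (BoolMatrix m n) (BoolMatrix (suc m) n) (λ G≈H → G≈H ∘ suc) (allMatrices-unique m n))
    (allBoolFuns-unique n)

allᵇ⁻ : ∀ {A : Set} (p : A → Bool) xs → T (allᵇ p xs) → All (T ∘ p) xs
allᵇ⁻ p [] _ = []
allᵇ⁻ p (x ∷ xs) px∧ = let (px , pxs) = Equivalence.to T-∧ px∧ in px ∷ allᵇ⁻ p xs pxs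

allᵇ⁺ : ∀ {A : Set} (p : A → Bool) {xs} → All (T ∘ p) xs → T (allᵇ p xs)
allᵇ⁺ p [] = _
allᵇ⁺ p (px ∷ pxs) = Equivalence.from T-∧ (px , allᵇ⁺ p pxs)

module _ {n : ℕ} {a b : Vector ℕ n} where

  realizesᵇ-sound : ∀ {G} → T (realizesᵇ a b G) → Realizes a b G
  realizesᵇ-sound {G} R = (λ v → proj₁ (at v)) , λ v → proj₂ (at v)
    where
    at : ∀ v → G v v ≡ false × indeg G v ≡ a v × outdeg G v ≡ b v
    at v with Equivalence.to (T-∧ {not (G v v)}) (All.lookup (allᵇ⁻ _ (allFin n) R) (∈-allFin v))
    ... | loopless , degrees with Equivalence.to (T-∧ {does (indeg G v ℕ.≟ a v)}) degrees
    ...   | in≡ , out≡ = Equivalence.to T-not-≡ loopless , ≡ᵇ⇒≡ _ _ in≡ , ≡ᵇ⇒≡ _ _ out≡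

  realizesᵇ-complete : ∀ {G} → Realizes a b G → T (realizesᵇ a b G)
  realizesᵇ-complete {G} (loopless , degrees) = allᵇ⁺ _ (All.universal at (allFin n))
    where
    at : ∀ v → T (not (G v v) ∧ does (indeg G v ℕ.≟ a v) ∧ does (outdeg G v ℕ.≟ b v))
    at v = Equivalence.from T-∧ (Equivalence.from T-not-≡ (loopless v) ,
             Equivalence.from T-∧ (≡⇒≡ᵇ _ _ (proj₁ (degrees v)) , ≡⇒≡ᵇ _ _ (proj₂ (degrees v))))

_≋_ : ∀ {n} → Digraph n → Digraph n → Set
G ≋ H = ∀ u v → G u v ≡ H u v

realizes-resp-≋ : ∀ {n} {a b : Vector ℕ n} {G H} → G ≋ H → Realizes a b G → Realizes a b H
realizes-resp-≋ G≋H (loopless , degrees) =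
  (λ v → trans (sym (G≋H v v)) (loopless v)) ,
  λ v → trans (countFin-cong (λ u → sym (G≋H u v))) (proj₁ (degrees v)) ,
        trans (countFin-cong (λ w → sym (G≋H v w))) (proj₂ (degrees v))

N₂-mono : ∀ {n} {a b a′ b′ : Vector ℕ n} (φ : Digraph n → Digraph n) →
  (∀ {G} → Realizes a b G → Realizes a′ b′ (φ G)) →
  (∀ {G H} → Realizes a b G → Realizes a b H → φ G ≋ φ H → G ≋ H) → N₂ a b ≤ N₂ a′ b′
N₂-mono {n} φ φ-realizes φ-injective =
  length-filterᵇ-≤ (BoolMatrix n n) (allMatrices-complete n n) (allMatrices-unique n n)
    (λ G≋H → realizesᵇ-complete ∘ realizes-resp-≋ G≋H ∘ realizesᵇ-sound)
    φ (realizesᵇ-complete ∘ φ-realizes ∘ realizesᵇ-sound)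
    (λ RG RH → φ-injective (realizesᵇ-sound RG) (realizesᵇ-sound RH))

-- Bracket matching in masked Boolean words

-- The entries of w selected by the mask m are read as a bracket word with 1 = "(" and 0 = ")":
-- unmatchedZeros counts the unmatched ")" and hasUnmatchedOne tells whether some "(" is
-- unmatched; raise turns the last unmatched ")" into "(", lower the first unmatched "(" into ")".
ones zeros : ∀ {n} (m w : Vector Bool n) → ℕ
ones m w = countFin (λ k → m k ∧ w k)
zeros m w = countFin (λ k → m k ∧ not (w k))

unmatchedZerosStep : Bool → Bool → ℕ → ℕ
unmatchedZerosStep false _ r = r
unmatchedZerosStep true true r = ℕ.pred r
unmatchedZerosStep true false r = suc r

unmatchedZeros : ∀ {n} (m w : Vector Bool n) → ℕ
unmatchedZeros {zero} m w = 0
unmatchedZeros {suc n} m w = unmatchedZerosStep (head m) (head w) (unmatchedZeros (tail m) (tail w))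

raiseStep : ∀ {n} → Bool → Bool → ℕ → (w′ r : Vector Bool n) → Vector Bool (suc n)
raiseStep false x _ w′ r = x ◂ r
raiseStep true true _ w′ r = true ◂ r
raiseStep true false zero w′ r = true ◂ w′
raiseStep true false (suc _) w′ r = false ◂ r

raise : ∀ {n} (m w : Vector Bool n) → Vector Bool n
raise {zero} m w = w
raise {suc n} m w = raiseStep (head m) (head w) (unmatchedZeros (tail m) (tail w)) (tail w) (raise (tail m) (tail w))

raise-unmatchedZeros : ∀ {n} (m w : Vector Bool n) → 0 < unmatchedZeros m w →
  suc (unmatchedZeros m (raise m w)) ≡ unmatchedZeros m w
raise-unmatchedZeros {suc n} m w 0<u
  with head m | head w | unmatchedZeros (tail m) (tail w) in eq | raise-unmatchedZeros (tail m) (tail w)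
... | false | _ | _ | ih = ih 0<u
... | true | true | suc (suc r) | ih = cong (λ x → suc (x ℕ.∸ 2)) (ih (s≤s z≤n))
... | true | false | zero | _ rewrite eq = refl
... | true | false | suc r | ih = cong suc (ih (s≤s z≤n))

m+n≤suc[m]+pred[n] : ∀ m n → m + n ≤ suc m + ℕ.pred n
m+n≤suc[m]+pred[n] m zero = n≤1+n (m + 0)
m+n≤suc[m]+pred[n] m (suc n) = ≤-reflexive (+-suc m n)

zeros≤ones+unmatchedZeros : ∀ {n} (m w : Vector Bool n) → zeros m w ≤ ones m w + unmatchedZeros m w
zeros≤ones+unmatchedZeros {zero} m w = z≤n
zeros≤ones+unmatchedZeros {suc n} m w
  with head m | head w | zeros≤ones+unmatchedZeros (tail m) (tail w)
... | false | _ | ih = ih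
... | true | true | ih = ≤-trans ih (m+n≤suc[m]+pred[n] (ones (tail m) (tail w)) (unmatchedZeros (tail m) (tail w)))
... | true | false | ih = ≤-trans (s≤s ih) (≤-reflexive (sym (+-suc _ _)))

ones<zeros⇒0<unmatchedZeros : ∀ {n} (m w : Vector Bool n) → ones m w < zeros m w → 0 < unmatchedZeros m w
ones<zeros⇒0<unmatchedZeros m w o<z with unmatchedZeros m w | zeros≤ones+unmatchedZeros m w
... | zero | z≤o+0 = contradiction (≤-trans o<z (≤-trans z≤o+0 (≤-reflexive (+-identityʳ _)))) (n≮n _)
... | suc _ | _ = s≤s z≤n

zeros-not : ∀ {n} (m v : Vector Bool n) → zeros m (not ∘ v) ≡ ones m v
zeros-not m v = countFin-cong (λ k → cong (m k ∧_) (not-involutive (v k)))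

raise-ones-zeros : ∀ {n} (m w : Vector Bool n) → 0 < unmatchedZeros m w →
  ones m (raise m w) ≡ suc (ones m w) × suc (zeros m (raise m w)) ≡ zeros m w
raise-ones-zeros {suc n} m w 0<u
  with head m | head w | unmatchedZeros (tail m) (tail w) | raise-ones-zeros (tail m) (tail w)
... | false | _ | _ | ih = ih 0<u
... | true | true | suc (suc r) | ih = let (o , z) = ih (s≤s z≤n) in cong suc o , z
... | true | false | zero | _ = refl , refl
... | true | false | suc r | ih = let (o , z) = ih (s≤s z≤n) in o , cong suc z

hasUnmatchedOneStep : Bool → Bool → ℕ → Bool → Bool
hasUnmatchedOneStep false _ _ r = r
hasUnmatchedOneStep true false _ r = r
hasUnmatchedOneStep true true zero r = true
hasUnmatchedOneStep true true (suc _) r = r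

hasUnmatchedOne : ∀ {n} (m v : Vector Bool n) → Bool
hasUnmatchedOne {zero} m v = false
hasUnmatchedOne {suc n} m v =
  hasUnmatchedOneStep (head m) (head v) (unmatchedZeros (tail m) (tail v)) (hasUnmatchedOne (tail m) (tail v))

lowerStep : ∀ {n} → Bool → Bool → ℕ → (v′ r : Vector Bool n) → Vector Bool (suc n)
lowerStep false x _ v′ r = x ◂ r
lowerStep true false _ v′ r = false ◂ r
lowerStep true true zero v′ r = false ◂ v′
lowerStep true true (suc _) v′ r = true ◂ r

lower : ∀ {n} (m v : Vector Bool n) → Vector Bool n
lower {zero} m v = v
lower {suc n} m v = lowerStep (head m) (head v) (unmatchedZeros (tail m) (tail v)) (tail v) (lower (tail m) (tail v))

raise-hasUnmatchedOne : ∀ {n} (m w : Vector Bool n) → 0 < unmatchedZeros m w →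
  hasUnmatchedOne m (raise m w) ≡ true
raise-hasUnmatchedOne {suc n} m w 0<u
  with head m | head w | unmatchedZeros (tail m) (tail w) in eq
     | raise-unmatchedZeros (tail m) (tail w) | raise-hasUnmatchedOne (tail m) (tail w)
... | false | _ | _ | _ | ih = ih 0<u
... | true | true | suc (suc r) | u-raise | ih rewrite suc-injective (u-raise (s≤s z≤n)) = ih (s≤s z≤n)
... | true | false | zero | _ | _ rewrite eq = refl
... | true | false | suc r | _ | ih = ih (s≤s z≤n)

lower-raise : ∀ {n} (m w : Vector Bool n) → 0 < unmatchedZeros m w → lower m (raise m w) ≗ w
lower-raise {suc n} m w 0<u zero
  with head m | head w | unmatchedZeros (tail m) (tail w) in eq | raise-unmatchedZeros (tail m) (tail w)
... | false | _ | _ | _ = refl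
... | true | true | suc (suc r) | u-raise rewrite suc-injective (u-raise (s≤s z≤n)) = refl
... | true | false | zero | _ rewrite eq = refl
... | true | false | suc r | _ = refl
lower-raise {suc n} m w 0<u (suc k)
  with head m | head w | unmatchedZeros (tail m) (tail w) in eq
     | raise-unmatchedZeros (tail m) (tail w) | lower-raise (tail m) (tail w)
... | false | _ | _ | _ | ih = ih 0<u k
... | true | true | suc (suc r) | u-raise | ih rewrite suc-injective (u-raise (s≤s z≤n)) = ih (s≤s z≤n) k
... | true | false | zero | _ | _ rewrite eq = refl
... | true | false | suc r | _ | ih = ih (s≤s z≤n) k

lower-unmatchedZeros : ∀ {n} (m v : Vector Bool n) → hasUnmatchedOne m v ≡ true →
  unmatchedZeros m (lower m v) ≡ suc (unmatchedZeros m v)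
lower-unmatchedZeros {suc n} m v h
  with head m | head v | unmatchedZeros (tail m) (tail v) in eq | lower-unmatchedZeros (tail m) (tail v)
... | false | _ | _ | ih = ih h
... | true | false | _ | ih = cong suc (ih h)
... | true | true | zero | _ rewrite eq = refl
... | true | true | suc r | ih = cong ℕ.pred (ih h)

raise-lower : ∀ {n} (m v : Vector Bool n) → hasUnmatchedOne m v ≡ true → raise m (lower m v) ≗ v
raise-lower {suc n} m v h zero
  with head m | head v | unmatchedZeros (tail m) (tail v) in eq | lower-unmatchedZeros (tail m) (tail v)
... | false | _ | _ | _ = refl
... | true | false | _ | u-lower rewrite u-lower h = refl
... | true | true | zero | _ rewrite eq = refl
... | true | true | suc r | _ = refl
raise-lower {suc n} m v h (suc k)
  with head m | head v | unmatchedZeros (tail m) (tail v) in eq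
     | lower-unmatchedZeros (tail m) (tail v) | raise-lower (tail m) (tail v)
... | false | _ | _ | _ | ih = ih h k
... | true | false | _ | u-lower | ih rewrite u-lower h = ih h k
... | true | true | zero | _ | _ rewrite eq = refl
... | true | true | suc r | _ | ih = ih h k

lower-ones-zeros : ∀ {n} (m v : Vector Bool n) → hasUnmatchedOne m v ≡ true →
  suc (ones m (lower m v)) ≡ ones m v × zeros m (lower m v) ≡ suc (zeros m v)
lower-ones-zeros m v h with raise-ones-zeros m (lower m v) (subst (0 <_) (sym (lower-unmatchedZeros m v h)) (s≤s z≤n))
... | o , z = trans (sym o) (countFin-cong (λ k → cong (m k ∧_) (raise-lower m v h k))) ,
              trans (sym z) (cong suc (countFin-cong (λ k → cong (λ x → m k ∧ not x) (raise-lower m v h k))))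

AgreeOn : ∀ {n} → Vector Bool n → Vector Bool n → Vector Bool n → Set
AgreeOn m v v′ = ∀ k → m k ≡ true → v k ≡ v′ k

unmatchedZeros-cong : ∀ {n} {m m′ w w′ : Vector Bool n} → m ≗ m′ → AgreeOn m w w′ →
  unmatchedZeros m w ≡ unmatchedZeros m′ w′
unmatchedZeros-cong {zero} _ _ = refl
unmatchedZeros-cong {suc n} {m} m≗m′ w≈w′ rewrite sym (m≗m′ zero)
  with head m | w≈w′ zero | unmatchedZeros-cong (m≗m′ ∘ suc) (w≈w′ ∘ suc)
... | false | _ | ih = ih
... | true | w₀≡ | ih = cong₂ (unmatchedZerosStep true) (w₀≡ refl) ih

hasUnmatchedOne-cong : ∀ {n} {m m′ v v′ : Vector Bool n} → m ≗ m′ → AgreeOn m v v′ →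
  hasUnmatchedOne m v ≡ hasUnmatchedOne m′ v′
hasUnmatchedOne-cong {zero} _ _ = refl
hasUnmatchedOne-cong {suc n} {m} m≗m′ v≈v′ rewrite sym (m≗m′ zero)
  with head m | v≈v′ zero | unmatchedZeros-cong (m≗m′ ∘ suc) (v≈v′ ∘ suc)
     | hasUnmatchedOne-cong (m≗m′ ∘ suc) (v≈v′ ∘ suc)
... | false | _ | _ | ih = ih
... | true | v₀≡ | u≡ | ih rewrite v₀≡ refl | u≡ | ih = refl

◂-head-tail : ∀ {n} (m : Vector Bool (suc n)) k → m k ≡ (head m ◂ tail m) k
◂-head-tail m zero = refl
◂-head-tail m (suc k) = refl

raiseStep-cong : ∀ {n} b {x x′} r {mt w w′ s s′ : Vector Bool n} → (b ≡ true → x ≡ x′) →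
  AgreeOn mt w w′ → AgreeOn mt s s′ → AgreeOn (b ◂ mt) (raiseStep b x r w s) (raiseStep b x′ r w′ s′)
raiseStep-cong false r _ _ s≈s′ (suc k) = s≈s′ k
raiseStep-cong true {x} r x≡x′ w≈w′ s≈s′ k with x≡x′ refl
raiseStep-cong true {true} r _ _ _ zero | refl = λ _ → refl
raiseStep-cong true {true} r _ _ s≈s′ (suc k) | refl = s≈s′ k
raiseStep-cong true {false} zero _ _ _ zero | refl = λ _ → refl
raiseStep-cong true {false} zero _ w≈w′ _ (suc k) | refl = w≈w′ k
raiseStep-cong true {false} (suc r) _ _ _ zero | refl = λ _ → refl
raiseStep-cong true {false} (suc r) _ _ s≈s′ (suc k) | refl = s≈s′ k

raise-cong : ∀ {n} {m m′ w w′ : Vector Bool n} → m ≗ m′ → AgreeOn m w w′ →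
  AgreeOn m (raise m w) (raise m′ w′)
raise-cong {suc n} {m} m≗m′ w≈w′ k mk rewrite sym (m≗m′ zero) | unmatchedZeros-cong (m≗m′ ∘ suc) (w≈w′ ∘ suc) =
  raiseStep-cong (head m) _ (w≈w′ zero) (w≈w′ ∘ suc) (raise-cong (m≗m′ ∘ suc) (w≈w′ ∘ suc)) k
    (trans (sym (◂-head-tail m k)) mk)

lowerStep-cong : ∀ {n} b {x x′} r {mt v v′ s s′ : Vector Bool n} → (b ≡ true → x ≡ x′) →
  AgreeOn mt v v′ → AgreeOn mt s s′ → AgreeOn (b ◂ mt) (lowerStep b x r v s) (lowerStep b x′ r v′ s′)
lowerStep-cong false r _ _ s≈s′ (suc k) = s≈s′ k
lowerStep-cong true {x} r x≡x′ v≈v′ s≈s′ k with x≡x′ refl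
lowerStep-cong true {false} r _ _ _ zero | refl = λ _ → refl
lowerStep-cong true {false} r _ _ s≈s′ (suc k) | refl = s≈s′ k
lowerStep-cong true {true} zero _ _ _ zero | refl = λ _ → refl
lowerStep-cong true {true} zero _ v≈v′ _ (suc k) | refl = v≈v′ k
lowerStep-cong true {true} (suc r) _ _ _ zero | refl = λ _ → refl
lowerStep-cong true {true} (suc r) _ _ s≈s′ (suc k) | refl = s≈s′ k

lower-cong : ∀ {n} {m m′ v v′ : Vector Bool n} → m ≗ m′ → AgreeOn m v v′ →
  AgreeOn m (lower m v) (lower m′ v′)
lower-cong {suc n} {m} m≗m′ v≈v′ k mk rewrite sym (m≗m′ zero) | unmatchedZeros-cong (m≗m′ ∘ suc) (v≈v′ ∘ suc) =
  lowerStep-cong (head m) _ (v≈v′ zero) (v≈v′ ∘ suc) (lower-cong (m≗m′ ∘ suc) (v≈v′ ∘ suc)) k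
    (trans (sym (◂-head-tail m k)) mk)

-- Exchanging the in-degrees of i and j

column : ∀ {n} → Digraph n → Fin n → Vector Bool n
column G c r = G r c

module Switch {n : ℕ} (i j : Fin n) (i≢j : i ≢ j) where

  isI isJ other : Vector Bool n
  isI k = does (k ≟ i)
  isJ k = does (k ≟ j)
  other k = not (isI k) ∧ not (isJ k)

  isI-i : isI i ≡ true
  isI-i = dec-true (i ≟ i) refl

  isJ-j : isJ j ≡ true
  isJ-j = dec-true (j ≟ j) refl

  isI-j : isI j ≡ false
  isI-j = dec-false (j ≟ i) (i≢j ∘ sym)

  other-i : other i ≡ false
  other-i rewrite isI-i = refl

  other-j : other j ≡ false
  other-j rewrite isI-j | isJ-j = refl

  other⇒¬isI : ∀ {k} → other k ≡ true → isI k ≡ false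
  other⇒¬isI {k} _ with isI k
  ... | false = refl

  other⇒¬isJ : ∀ {k} → other k ≡ true → isJ k ≡ false
  other⇒¬isJ {k} _ with isI k | isJ k
  ... | false | false = refl

  data Position : Fin n → Set where
    at-i : Position i
    at-j : Position j
    elsewhere : ∀ {k} → other k ≡ true → Position k

  position : ∀ k → Position k
  position k with k ≟ i | k ≟ j
  ... | yes refl | _ = at-i
  ... | no _ | yes refl = at-j
  ... | no k≢i | no k≢j = elsewhere (cong₂ (λ x y → not x ∧ not y) (dec-false (k ≟ i) k≢i) (dec-false (k ≟ j) k≢j))

  position-i : position i ≡ at-i
  position-i with i ≟ i
  ... | yes refl = refl
  ... | no i≢i = ⊥-elim (i≢i refl)

  position-j : position j ≡ at-j
  position-j with j ≟ i | j ≟ j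
  ... | yes j≡i | _ = ⊥-elim (i≢j (sym j≡i))
  ... | no _ | yes refl = refl
  ... | no _ | no j≢j = ⊥-elim (j≢j refl)

  position-other : ∀ {k} (o : other k ≡ true) → position k ≡ elsewhere o
  position-other {k} o with position k
  ... | at-i = contradiction (trans (sym other-i) o) λ ()
  ... | at-j = contradiction (trans (sym other-j) o) λ ()
  ... | elsewhere o′ = cong elsewhere (Decidable⇒UIP.≡-irrelevant Bool._≟_ o′ o)

  countFin-ij : (f : Vector Bool n) → countFin f ≡ ⟦ f i ⟧ + (⟦ f j ⟧ + countFin (λ k → other k ∧ f k))
  countFin-ij f = begin
    countFin f                                                    ≡⟨ countFin-point f i ⟩
    ⟦ f i ⟧ + countFin (λ k → not (isI k) ∧ f k)                 ≡⟨ cong (⟦ f i ⟧ +_) (countFin-point _ j) ⟩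
    ⟦ f i ⟧ + (⟦ not (isI j) ∧ f j ⟧ + countFin (λ k → not (isJ k) ∧ (not (isI k) ∧ f k)))
      ≡⟨ cong (λ x → ⟦ f i ⟧ + (⟦ not x ∧ f j ⟧ + countFin (λ k → not (isJ k) ∧ (not (isI k) ∧ f k)))) isI-j ⟩
    ⟦ f i ⟧ + (⟦ f j ⟧ + countFin (λ k → not (isJ k) ∧ (not (isI k) ∧ f k)))
      ≡⟨ cong (λ x → ⟦ f i ⟧ + (⟦ f j ⟧ + x)) (countFin-cong λ k →
           trans (sym (∧-assoc (not (isJ k)) _ (f k))) (cong (_∧ f k) (∧-comm (not (isJ k)) (not (isI k))))) ⟩
    ⟦ f i ⟧ + (⟦ f j ⟧ + countFin (λ k → other k ∧ f k))        ∎
    where open ≡-Reasoning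

  rowDiff colDiff : Digraph n → Vector Bool n
  rowDiff G c = other c ∧ (G i c xor G j c)
  colDiff G r = other r ∧ (G r i xor G r j)

  rowDiff-i : ∀ G → rowDiff G i ≡ false
  rowDiff-i G = cong (_∧ (G i i xor G j i)) other-i

  rowDiff-j : ∀ G → rowDiff G j ≡ false
  rowDiff-j G = cong (_∧ (G i j xor G j j)) other-j

  colDiff-i : ∀ G → colDiff G i ≡ false
  colDiff-i G = cong (_∧ (G i i xor G i j)) other-i

  colDiff-j : ∀ G → colDiff G j ≡ false
  colDiff-j G = cong (_∧ (G j i xor G j j)) other-j

  rowDiff⇒other : ∀ {G c} → rowDiff G c ≡ true → other c ≡ true
  rowDiff⇒other {G} {c} = ∧-conicalˡ (other c) _

  colDiff⇒other : ∀ {G r} → colDiff G r ≡ true → other r ≡ true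
  colDiff⇒other {G} {r} = ∧-conicalˡ (other r) _

  rowDiff⇒≡not : ∀ {G c} → rowDiff G c ≡ true → G j c ≡ not (G i c)
  rowDiff⇒≡not {G} {c} d with other c | G i c | G j c
  ... | true | true | false = refl
  ... | true | false | true = refl

  colDiff⇒≡not : ∀ {G r} → colDiff G r ≡ true → G r j ≡ not (G r i)
  colDiff⇒≡not {G} {r} d with other r | G r i | G r j
  ... | true | true | false = refl
  ... | true | false | true = refl

  ¬rowDiff⇒≡ : ∀ {G c} → other c ≡ true → rowDiff G c ≡ false → G j c ≡ G i c
  ¬rowDiff⇒≡ {G} {c} o d with other c | G i c | G j c
  ... | true | true | true = refl
  ... | true | false | false = refl

  ¬colDiff⇒≡ : ∀ {G r} → other r ≡ true → colDiff G r ≡ false → G r j ≡ G r i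
  ¬colDiff⇒≡ {G} {r} o d with other r | G r i | G r j
  ... | true | true | true = refl
  ... | true | false | false = refl

  countFin-decompose : (M f w g : Vector Bool n) → (∀ {k} → M k ≡ true → other k ≡ true) →
    AgreeOn M f w → (∀ {k} → other k ≡ true → M k ≡ false → f k ≡ g k) →
    countFin f ≡ ⟦ f i ⟧ + (⟦ f j ⟧ + (ones M w + countFin (λ k → not (M k) ∧ (other k ∧ g k))))
  countFin-decompose M f w g M⇒other f≈w f≈g = begin
    countFin f                                                        ≡⟨ countFin-ij f ⟩
    ⟦ f i ⟧ + (⟦ f j ⟧ + countFin (λ k → other k ∧ f k))               ≡⟨ cong (λ z → ⟦ f i ⟧ + (⟦ f j ⟧ + z)) split ⟩
    ⟦ f i ⟧ + (⟦ f j ⟧ + (ones M w + countFin (λ k → not (M k) ∧ (other k ∧ g k)))) ∎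
    where
    open ≡-Reasoning
    onM : ∀ k → M k ∧ (other k ∧ f k) ≡ M k ∧ w k
    onM k with M k in eq
    ... | false = refl
    ... | true with other k | M⇒other eq
    ...   | _ | refl = f≈w k eq
    offM : ∀ k → not (M k) ∧ (other k ∧ f k) ≡ not (M k) ∧ (other k ∧ g k)
    offM k with M k in eq | other k in eo
    ... | true | _ = refl
    ... | false | false = refl
    ... | false | true = f≈g eo eq
    split : countFin (λ k → other k ∧ f k) ≡ ones M w + countFin (λ k → not (M k) ∧ (other k ∧ g k))
    split = trans (countFin-split M _) (cong₂ _+_ (countFin-cong onM) (countFin-cong offM))

  countFin-pair : (f g : Vector Bool n) → (∀ {k} → other k ≡ true → f k ≡ g k) →
    ⟦ f i ⟧ + ⟦ f j ⟧ ≡ ⟦ g i ⟧ + ⟦ g j ⟧ → countFin f ≡ countFin g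
  countFin-pair f g f≈g ij-sum = begin
    countFin f                                               ≡⟨ countFin-ij f ⟩
    ⟦ f i ⟧ + (⟦ f j ⟧ + countFin (λ k → other k ∧ f k))      ≡⟨ +-assoc ⟦ f i ⟧ _ _ ⟨
    (⟦ f i ⟧ + ⟦ f j ⟧) + countFin (λ k → other k ∧ f k)      ≡⟨ cong₂ _+_ ij-sum (countFin-cong elsewhere-equal) ⟩
    (⟦ g i ⟧ + ⟦ g j ⟧) + countFin (λ k → other k ∧ g k)      ≡⟨ +-assoc ⟦ g i ⟧ _ _ ⟩
    ⟦ g i ⟧ + (⟦ g j ⟧ + countFin (λ k → other k ∧ g k))      ≡⟨ countFin-ij g ⟨
    countFin g                                               ∎
    where
    open ≡-Reasoning
    elsewhere-equal : ∀ k → other k ∧ f k ≡ other k ∧ g k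
    elsewhere-equal k with other k in o
    ... | false = refl
    ... | true = f≈g o

  rowRest colRest : Digraph n → ℕ
  rowRest G = countFin (λ k → not (rowDiff G k) ∧ (other k ∧ G i k))
  colRest G = countFin (λ k → not (colDiff G k) ∧ (other k ∧ G k i))

  private
    drop-loop-i : ∀ {x a a′} o r → x ≡ false → a ≡ a′ → ⟦ x ⟧ + (⟦ a ⟧ + (o + r)) ≡ (⟦ a′ ⟧ + o) + r
    drop-loop-i o r refl refl = sym (+-assoc _ o r)

    drop-loop-j : ∀ {x a a′} o r → x ≡ false → a ≡ a′ → ⟦ a ⟧ + (⟦ x ⟧ + (o + r)) ≡ (⟦ a′ ⟧ + o) + r
    drop-loop-j o r refl refl = sym (+-assoc _ o r)

  module _ (G : Digraph n) where

    outdeg-i : G i i ≡ false → outdeg G i ≡ (⟦ G i j ⟧ + ones (rowDiff G) (G i)) + rowRest G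
    outdeg-i loop = trans (countFin-decompose (rowDiff G) (G i) (G i) (G i) (rowDiff⇒other {G}) (λ _ _ → refl) (λ _ _ → refl))
                          (drop-loop-i {a = G i j} _ _ loop refl)

    outdeg-j : G j j ≡ false → outdeg G j ≡ (⟦ G j i ⟧ + zeros (rowDiff G) (G i)) + rowRest G
    outdeg-j loop = trans (countFin-decompose (rowDiff G) (G j) (not ∘ G i) (G i) (rowDiff⇒other {G})
                                              (λ _ → rowDiff⇒≡not {G}) (¬rowDiff⇒≡ {G}))
                          (drop-loop-j {a = G j i} _ _ loop refl)

    indeg-i : G i i ≡ false → indeg G i ≡ (⟦ G j i ⟧ + ones (colDiff G) (column G i)) + colRest G
    indeg-i loop = trans (countFin-decompose (colDiff G) (column G i) (column G i) (column G i) (colDiff⇒other {G})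
                                             (λ _ _ → refl) (λ _ _ → refl))
                         (drop-loop-i {a = G j i} _ _ loop refl)

    indeg-j : G j j ≡ false → indeg G j ≡ (⟦ G i j ⟧ + zeros (colDiff G) (column G i)) + colRest G
    indeg-j loop = trans (countFin-decompose (colDiff G) (column G j) (not ∘ column G i) (column G i) (colDiff⇒other {G})
                                             (λ _ → colDiff⇒≡not {G}) (¬colDiff⇒≡ {G}))
                         (drop-loop-j {a = G i j} _ _ loop refl)

  switch : Digraph n → (x y : Bool) (W V : Vector Bool n) → Digraph n
  switch G x y W V r c = entry (position r) (position c)
    where
    entry : ∀ {r c} → Position r → Position c → Bool
    entry at-i at-i = G i i
    entry at-i at-j = x
    entry at-i (elsewhere {c} _) = if rowDiff G c then W c else G i c
    entry at-j at-i = y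
    entry at-j at-j = G j j
    entry at-j (elsewhere {c} _) = if rowDiff G c then not (W c) else G j c
    entry (elsewhere {r} _) at-i = if colDiff G r then V r else G r i
    entry (elsewhere {r} _) at-j = if colDiff G r then not (V r) else G r j
    entry (elsewhere {r} _) (elsewhere {c} _) = G r c

  module _ (G : Digraph n) (x y : Bool) (W V : Vector Bool n) where

    switch-ij : switch G x y W V i j ≡ x
    switch-ij with position i | position-i | position j | position-j
    ... | _ | refl | _ | refl = refl

    switch-ji : switch G x y W V j i ≡ y
    switch-ji with position i | position-i | position j | position-j
    ... | _ | refl | _ | refl = refl

    switch-ii : switch G x y W V i i ≡ G i i
    switch-ii with position i | position-i
    ... | _ | refl = refl

    switch-jj : switch G x y W V j j ≡ G j j
    switch-jj with position j | position-j
    ... | _ | refl = refl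

    switch-other : ∀ {r c} → other r ≡ true → other c ≡ true → switch G x y W V r c ≡ G r c
    switch-other {r} {c} or oc with position r | position-other {r} or | position c | position-other {c} oc
    ... | _ | refl | _ | refl = refl

    switch-row-i : ∀ {c} → other c ≡ true → switch G x y W V i c ≡ (if rowDiff G c then W c else G i c)
    switch-row-i {c} o with position i | position-i | position c | position-other {c} o
    ... | _ | refl | _ | refl = refl

    switch-row-j : ∀ {c} → other c ≡ true → switch G x y W V j c ≡ (if rowDiff G c then not (W c) else G j c)
    switch-row-j {c} o with position j | position-j | position c | position-other {c} o
    ... | _ | refl | _ | refl = refl

    switch-col-i : ∀ {r} → other r ≡ true → switch G x y W V r i ≡ (if colDiff G r then V r else G r i)
    switch-col-i {r} o with position r | position-other {r} o | position i | position-i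
    ... | _ | refl | _ | refl = refl

    switch-col-j : ∀ {r} → other r ≡ true → switch G x y W V r j ≡ (if colDiff G r then not (V r) else G r j)
    switch-col-j {r} o with position r | position-other {r} o | position j | position-j
    ... | _ | refl | _ | refl = refl

    switch-row-i-on : ∀ {c} → rowDiff G c ≡ true → switch G x y W V i c ≡ W c
    switch-row-i-on {c} d = trans (switch-row-i (rowDiff⇒other {G} d)) (if-true d)

    switch-row-j-on : ∀ {c} → rowDiff G c ≡ true → switch G x y W V j c ≡ not (W c)
    switch-row-j-on {c} d = trans (switch-row-j (rowDiff⇒other {G} d)) (if-true d)

    switch-col-i-on : ∀ {r} → colDiff G r ≡ true → switch G x y W V r i ≡ V r
    switch-col-i-on {r} d = trans (switch-col-i (colDiff⇒other {G} d)) (if-true d)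

    switch-col-j-on : ∀ {r} → colDiff G r ≡ true → switch G x y W V r j ≡ not (V r)
    switch-col-j-on {r} d = trans (switch-col-j (colDiff⇒other {G} d)) (if-true d)

    switch-row-i-off : ∀ {c} → other c ≡ true → rowDiff G c ≡ false → switch G x y W V i c ≡ G i c
    switch-row-i-off o d = trans (switch-row-i o) (if-false d)

    switch-row-j-off : ∀ {c} → other c ≡ true → rowDiff G c ≡ false → switch G x y W V j c ≡ G j c
    switch-row-j-off o d = trans (switch-row-j o) (if-false d)

    switch-col-i-off : ∀ {r} → other r ≡ true → colDiff G r ≡ false → switch G x y W V r i ≡ G r i
    switch-col-i-off o d = trans (switch-col-i o) (if-false d)

    switch-col-j-off : ∀ {r} → other r ≡ true → colDiff G r ≡ false → switch G x y W V r j ≡ G r j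
    switch-col-j-off o d = trans (switch-col-j o) (if-false d)

    outdeg-switch-i : G i i ≡ false → outdeg (switch G x y W V) i ≡ (⟦ x ⟧ + ones (rowDiff G) W) + rowRest G
    outdeg-switch-i loop =
      trans (countFin-decompose (rowDiff G) _ W (G i) (rowDiff⇒other {G}) (λ _ → switch-row-i-on) switch-row-i-off)
            (drop-loop-i _ _ (trans switch-ii loop) switch-ij)

    outdeg-switch-j : G j j ≡ false → outdeg (switch G x y W V) j ≡ (⟦ y ⟧ + zeros (rowDiff G) W) + rowRest G
    outdeg-switch-j loop =
      trans (countFin-decompose (rowDiff G) _ (not ∘ W) (G i) (rowDiff⇒other {G}) (λ _ → switch-row-j-on)
                                (λ o d → trans (switch-row-j-off o d) (¬rowDiff⇒≡ {G} o d)))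
            (drop-loop-j _ _ (trans switch-jj loop) switch-ji)

    indeg-switch-i : G i i ≡ false → indeg (switch G x y W V) i ≡ (⟦ y ⟧ + ones (colDiff G) V) + colRest G
    indeg-switch-i loop =
      trans (countFin-decompose (colDiff G) _ V (column G i) (colDiff⇒other {G}) (λ _ → switch-col-i-on)
                                switch-col-i-off)
            (drop-loop-i _ _ (trans switch-ii loop) switch-ji)

    indeg-switch-j : G j j ≡ false → indeg (switch G x y W V) j ≡ (⟦ x ⟧ + zeros (colDiff G) V) + colRest G
    indeg-switch-j loop =
      trans (countFin-decompose (colDiff G) _ (not ∘ V) (column G i) (colDiff⇒other {G}) (λ _ → switch-col-j-on)
                                (λ o d → trans (switch-col-j-off o d) (¬colDiff⇒≡ {G} o d)))
            (drop-loop-j _ _ (trans switch-jj loop) switch-ij)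

    outdeg-switch-other : ∀ {r} → other r ≡ true → outdeg (switch G x y W V) r ≡ outdeg G r
    outdeg-switch-other {r} o = countFin-pair _ (G r) (switch-other o) (pair (colDiff G r) refl)
      where
      pair : ∀ d → colDiff G r ≡ d →
        ⟦ switch G x y W V r i ⟧ + ⟦ switch G x y W V r j ⟧ ≡ ⟦ G r i ⟧ + ⟦ G r j ⟧
      pair true d = begin
        ⟦ switch G x y W V r i ⟧ + ⟦ switch G x y W V r j ⟧ ≡⟨ cong₂ (λ a b → ⟦ a ⟧ + ⟦ b ⟧) (switch-col-i-on d) (switch-col-j-on d) ⟩
        ⟦ V r ⟧ + ⟦ not (V r) ⟧                             ≡⟨ ⟦x⟧+⟦not-x⟧ (V r) ⟩
        1                                                   ≡⟨ ⟦x⟧+⟦not-x⟧ (G r i) ⟨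
        ⟦ G r i ⟧ + ⟦ not (G r i) ⟧                         ≡⟨ cong (λ b → ⟦ G r i ⟧ + ⟦ b ⟧) (colDiff⇒≡not {G} d) ⟨
        ⟦ G r i ⟧ + ⟦ G r j ⟧                               ∎
        where open ≡-Reasoning
      pair false d = cong₂ (λ a b → ⟦ a ⟧ + ⟦ b ⟧) (switch-col-i-off o d) (switch-col-j-off o d)

    indeg-switch-other : ∀ {c} → other c ≡ true → indeg (switch G x y W V) c ≡ indeg G c
    indeg-switch-other {c} o = countFin-pair _ (column G c) (λ o′ → switch-other o′ o) (pair (rowDiff G c) refl)
      where
      pair : ∀ d → rowDiff G c ≡ d →
        ⟦ switch G x y W V i c ⟧ + ⟦ switch G x y W V j c ⟧ ≡ ⟦ G i c ⟧ + ⟦ G j c ⟧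
      pair true d = begin
        ⟦ switch G x y W V i c ⟧ + ⟦ switch G x y W V j c ⟧ ≡⟨ cong₂ (λ a b → ⟦ a ⟧ + ⟦ b ⟧) (switch-row-i-on d) (switch-row-j-on d) ⟩
        ⟦ W c ⟧ + ⟦ not (W c) ⟧                             ≡⟨ ⟦x⟧+⟦not-x⟧ (W c) ⟩
        1                                                   ≡⟨ ⟦x⟧+⟦not-x⟧ (G i c) ⟨
        ⟦ G i c ⟧ + ⟦ not (G i c) ⟧                         ≡⟨ cong (λ b → ⟦ G i c ⟧ + ⟦ b ⟧) (rowDiff⇒≡not {G} d) ⟨
        ⟦ G i c ⟧ + ⟦ G j c ⟧                               ∎
        where open ≡-Reasoning
      pair false d = cong₂ (λ a b → ⟦ a ⟧ + ⟦ b ⟧) (switch-row-i-off o d) (switch-row-j-off o d)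

    rowDiff-switch : rowDiff (switch G x y W V) ≗ rowDiff G
    rowDiff-switch c = at (position c) (rowDiff G c) refl
      where
      at : ∀ {c} → Position c → ∀ d → rowDiff G c ≡ d → rowDiff (switch G x y W V) c ≡ rowDiff G c
      at at-i _ _ = trans (rowDiff-i (switch G x y W V)) (sym (rowDiff-i G))
      at at-j _ _ = trans (rowDiff-j (switch G x y W V)) (sym (rowDiff-j G))
      at {c} (elsewhere o) true d = begin
        other c ∧ (switch G x y W V i c xor switch G x y W V j c)
          ≡⟨ cong₂ (λ a b → other c ∧ (a xor b)) (switch-row-i-on d) (switch-row-j-on d) ⟩
        other c ∧ (W c xor not (W c))  ≡⟨ cong (other c ∧_) (xor-inverseʳ (W c)) ⟩
        other c ∧ true                 ≡⟨ ∧-identityʳ (other c) ⟩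
        other c                        ≡⟨ trans o (sym d) ⟩
        rowDiff G c                    ∎
        where open ≡-Reasoning
      at {c} (elsewhere o) false d =
        cong₂ (λ a b → other c ∧ (a xor b)) (switch-row-i-off o d) (switch-row-j-off o d)

    colDiff-switch : colDiff (switch G x y W V) ≗ colDiff G
    colDiff-switch r = at (position r) (colDiff G r) refl
      where
      at : ∀ {r} → Position r → ∀ d → colDiff G r ≡ d → colDiff (switch G x y W V) r ≡ colDiff G r
      at at-i _ _ = trans (colDiff-i (switch G x y W V)) (sym (colDiff-i G))
      at at-j _ _ = trans (colDiff-j (switch G x y W V)) (sym (colDiff-j G))
      at {r} (elsewhere o) true d = begin
        other r ∧ (switch G x y W V r i xor switch G x y W V r j)
          ≡⟨ cong₂ (λ a b → other r ∧ (a xor b)) (switch-col-i-on d) (switch-col-j-on d) ⟩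
        other r ∧ (V r xor not (V r))  ≡⟨ cong (other r ∧_) (xor-inverseʳ (V r)) ⟩
        other r ∧ true                 ≡⟨ ∧-identityʳ (other r) ⟩
        other r                        ≡⟨ trans o (sym d) ⟩
        colDiff G r                    ∎
        where open ≡-Reasoning
      at {r} (elsewhere o) false d =
        cong₂ (λ a b → other r ∧ (a xor b)) (switch-col-i-off o d) (switch-col-j-off o d)

  swapAt-i : (a : Vector ℕ n) → swapAt i j a i ≡ a j
  swapAt-i a = if-true isI-i

  swapAt-j : (a : Vector ℕ n) → swapAt i j a j ≡ a i
  swapAt-j a = trans (if-false isI-j) (if-true isJ-j)

  swapAt-other : (a : Vector ℕ n) → ∀ {k} → other k ≡ true → swapAt i j a k ≡ a k
  swapAt-other a {k} o = trans (if-false (other⇒¬isI {k} o)) (if-false (other⇒¬isJ {k} o))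

  switch-realizes : ∀ {a b : Vector ℕ n} {G} (x y : Bool) (W V : Vector Bool n) → Realizes a b G →
    ⟦ x ⟧ + ones (rowDiff G) W ≡ ⟦ G i j ⟧ + ones (rowDiff G) (G i) →
    ⟦ y ⟧ + zeros (rowDiff G) W ≡ ⟦ G j i ⟧ + zeros (rowDiff G) (G i) →
    ⟦ y ⟧ + ones (colDiff G) V ≡ ⟦ G i j ⟧ + zeros (colDiff G) (column G i) →
    ⟦ x ⟧ + zeros (colDiff G) V ≡ ⟦ G j i ⟧ + ones (colDiff G) (column G i) →
    Realizes (swapAt i j a) b (switch G x y W V)
  switch-realizes {a} {b} {G} x y W V (loopless , degrees) out-i out-j in-i in-j = loopless′ , degrees′
    where
    open ≡-Reasoning
    loopless-at : ∀ {k} → Position k → switch G x y W V k k ≡ false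
    loopless-at at-i = trans (switch-ii G x y W V) (loopless i)
    loopless-at at-j = trans (switch-jj G x y W V) (loopless j)
    loopless-at {k} (elsewhere o) = trans (switch-other G x y W V o o) (loopless k)
    loopless′ : Loopless (switch G x y W V)
    loopless′ k = loopless-at (position k)
    degrees-at : ∀ {v} → Position v → indeg (switch G x y W V) v ≡ swapAt i j a v × outdeg (switch G x y W V) v ≡ b v
    degrees′ : ∀ v → indeg (switch G x y W V) v ≡ swapAt i j a v × outdeg (switch G x y W V) v ≡ b v
    degrees′ v = degrees-at (position v)
    degrees-at at-i = (begin
      indeg (switch G x y W V) i                       ≡⟨ indeg-switch-i G x y W V (loopless i) ⟩
      (⟦ y ⟧ + ones (colDiff G) V) + colRest G           ≡⟨ cong (_+ colRest G) in-i ⟩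
      (⟦ G i j ⟧ + zeros (colDiff G) (column G i)) + colRest G ≡⟨ indeg-j G (loopless j) ⟨
      indeg G j                                        ≡⟨ proj₁ (degrees j) ⟩
      a j                                              ≡⟨ swapAt-i a ⟨
      swapAt i j a i                                   ∎) , (begin
      outdeg (switch G x y W V) i                      ≡⟨ outdeg-switch-i G x y W V (loopless i) ⟩
      (⟦ x ⟧ + ones (rowDiff G) W) + rowRest G           ≡⟨ cong (_+ rowRest G) out-i ⟩
      (⟦ G i j ⟧ + ones (rowDiff G) (G i)) + rowRest G   ≡⟨ outdeg-i G (loopless i) ⟨
      outdeg G i                                       ≡⟨ proj₂ (degrees i) ⟩
      b i                                              ∎)
    degrees-at at-j = (begin
      indeg (switch G x y W V) j                       ≡⟨ indeg-switch-j G x y W V (loopless j) ⟩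
      (⟦ x ⟧ + zeros (colDiff G) V) + colRest G          ≡⟨ cong (_+ colRest G) in-j ⟩
      (⟦ G j i ⟧ + ones (colDiff G) (column G i)) + colRest G ≡⟨ indeg-i G (loopless i) ⟨
      indeg G i                                        ≡⟨ proj₁ (degrees i) ⟩
      a i                                              ≡⟨ swapAt-j a ⟨
      swapAt i j a j                                   ∎) , (begin
      outdeg (switch G x y W V) j                      ≡⟨ outdeg-switch-j G x y W V (loopless j) ⟩
      (⟦ y ⟧ + zeros (rowDiff G) W) + rowRest G          ≡⟨ cong (_+ rowRest G) out-j ⟩
      (⟦ G j i ⟧ + zeros (rowDiff G) (G i)) + rowRest G  ≡⟨ outdeg-j G (loopless j) ⟨
      outdeg G j                                       ≡⟨ proj₂ (degrees j) ⟩
      b j                                              ∎)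
    degrees-at {v} (elsewhere o) =
      trans (indeg-switch-other G x y W V o) (trans (proj₁ (degrees v)) (sym (swapAt-other a o))) ,
      trans (outdeg-switch-other G x y W V o) (proj₂ (degrees v))

  module _ {G₁ G₂ : Digraph n} {x₁ y₁ x₂ y₂ : Bool} {W₁ V₁ W₂ V₂ : Vector Bool n}
           (same-image : switch G₁ x₁ y₁ W₁ V₁ ≋ switch G₂ x₂ y₂ W₂ V₂) where

    switch-cancel-rowDiff : rowDiff G₁ ≗ rowDiff G₂
    switch-cancel-rowDiff c = begin
      rowDiff G₁ c                                      ≡⟨ rowDiff-switch G₁ x₁ y₁ W₁ V₁ c ⟨
      rowDiff (switch G₁ x₁ y₁ W₁ V₁) c                 ≡⟨ cong₂ (λ a b → other c ∧ (a xor b)) (same-image i c) (same-image j c) ⟩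
      rowDiff (switch G₂ x₂ y₂ W₂ V₂) c                 ≡⟨ rowDiff-switch G₂ x₂ y₂ W₂ V₂ c ⟩
      rowDiff G₂ c                                      ∎
      where open ≡-Reasoning

    switch-cancel-colDiff : colDiff G₁ ≗ colDiff G₂
    switch-cancel-colDiff r = begin
      colDiff G₁ r                                      ≡⟨ colDiff-switch G₁ x₁ y₁ W₁ V₁ r ⟨
      colDiff (switch G₁ x₁ y₁ W₁ V₁) r                 ≡⟨ cong₂ (λ a b → other r ∧ (a xor b)) (same-image r i) (same-image r j) ⟩
      colDiff (switch G₂ x₂ y₂ W₂ V₂) r                 ≡⟨ colDiff-switch G₂ x₂ y₂ W₂ V₂ r ⟩
      colDiff G₂ r                                      ∎
      where open ≡-Reasoning

    switch-cancel-x : x₁ ≡ x₂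
    switch-cancel-x = trans (sym (switch-ij G₁ x₁ y₁ W₁ V₁)) (trans (same-image i j) (switch-ij G₂ x₂ y₂ W₂ V₂))

    switch-cancel-y : y₁ ≡ y₂
    switch-cancel-y = trans (sym (switch-ji G₁ x₁ y₁ W₁ V₁)) (trans (same-image j i) (switch-ji G₂ x₂ y₂ W₂ V₂))

    switch-cancel-W : AgreeOn (rowDiff G₁) W₁ W₂
    switch-cancel-W c d = trans (sym (switch-row-i-on G₁ x₁ y₁ W₁ V₁ d))
      (trans (same-image i c) (switch-row-i-on G₂ x₂ y₂ W₂ V₂ (trans (sym (switch-cancel-rowDiff c)) d)))

    switch-cancel-V : AgreeOn (colDiff G₁) V₁ V₂
    switch-cancel-V r d = trans (sym (switch-col-i-on G₁ x₁ y₁ W₁ V₁ d))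
      (trans (same-image r i) (switch-col-i-on G₂ x₂ y₂ W₂ V₂ (trans (sym (switch-cancel-colDiff r)) d)))

    switch-cancel : Loopless G₁ → Loopless G₂ → G₁ i j ≡ G₂ i j → G₁ j i ≡ G₂ j i →
      AgreeOn (rowDiff G₁) (G₁ i) (G₂ i) → AgreeOn (colDiff G₁) (column G₁ i) (column G₂ i) → G₁ ≋ G₂
    switch-cancel loopless₁ loopless₂ ij ji row col r c = at (position r) (position c)
      where
      row-i : ∀ {c} → other c ≡ true → ∀ d → rowDiff G₁ c ≡ d → G₁ i c ≡ G₂ i c
      row-i {c} o true d = row c d
      row-i {c} o false d = trans (sym (switch-row-i-off G₁ x₁ y₁ W₁ V₁ o d))
        (trans (same-image i c) (switch-row-i-off G₂ x₂ y₂ W₂ V₂ o (trans (sym (switch-cancel-rowDiff c)) d)))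
      row-j : ∀ {c} → other c ≡ true → ∀ d → rowDiff G₁ c ≡ d → G₁ j c ≡ G₂ j c
      row-j {c} o true d = trans (rowDiff⇒≡not {G₁} d)
        (trans (cong not (row c d)) (sym (rowDiff⇒≡not {G₂} (trans (sym (switch-cancel-rowDiff c)) d))))
      row-j {c} o false d = trans (sym (switch-row-j-off G₁ x₁ y₁ W₁ V₁ o d))
        (trans (same-image j c) (switch-row-j-off G₂ x₂ y₂ W₂ V₂ o (trans (sym (switch-cancel-rowDiff c)) d)))
      col-i : ∀ {r} → other r ≡ true → ∀ d → colDiff G₁ r ≡ d → G₁ r i ≡ G₂ r i
      col-i {r} o true d = col r d
      col-i {r} o false d = trans (sym (switch-col-i-off G₁ x₁ y₁ W₁ V₁ o d))
        (trans (same-image r i) (switch-col-i-off G₂ x₂ y₂ W₂ V₂ o (trans (sym (switch-cancel-colDiff r)) d)))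
      col-j : ∀ {r} → other r ≡ true → ∀ d → colDiff G₁ r ≡ d → G₁ r j ≡ G₂ r j
      col-j {r} o true d = trans (colDiff⇒≡not {G₁} d)
        (trans (cong not (col r d)) (sym (colDiff⇒≡not {G₂} (trans (sym (switch-cancel-colDiff r)) d))))
      col-j {r} o false d = trans (sym (switch-col-j-off G₁ x₁ y₁ W₁ V₁ o d))
        (trans (same-image r j) (switch-col-j-off G₂ x₂ y₂ W₂ V₂ o (trans (sym (switch-cancel-colDiff r)) d)))
      at : ∀ {r c} → Position r → Position c → G₁ r c ≡ G₂ r c
      at at-i at-i = trans (loopless₁ i) (sym (loopless₂ i))
      at at-i at-j = ij
      at at-i (elsewhere {c} o) = row-i o (rowDiff G₁ c) refl
      at at-j at-i = ji
      at at-j at-j = trans (loopless₁ j) (sym (loopless₂ j))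
      at at-j (elsewhere {c} o) = row-j o (rowDiff G₁ c) refl
      at (elsewhere {r} o) at-i = col-i o (colDiff G₁ r) refl
      at (elsewhere {r} o) at-j = col-j o (colDiff G₁ r) refl
      at (elsewhere {r} o) (elsewhere {c} o′) = trans (sym (switch-other G₁ x₁ y₁ W₁ V₁ o o′))
        (trans (same-image r c) (switch-other G₂ x₂ y₂ W₂ V₂ o o′))

  data Kind : Set where
    symmetric forward backward-row backward-col : Kind

  data Case (G : Digraph n) : Kind → Set where
    symmetric : G i j ≡ G j i → Case G symmetric
    forward : G i j ≡ true → G j i ≡ false → Case G forward
    backward-row : G i j ≡ false → G j i ≡ true → hasUnmatchedOne (rowDiff G) (G i) ≡ true → Case G backward-row
    backward-col : G i j ≡ false → G j i ≡ true → hasUnmatchedOne (rowDiff G) (G i) ≡ false → Case G backward-col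

  caseOf : ∀ G → Σ Kind (Case G)
  caseOf G with G i j in ij | G j i in ji | hasUnmatchedOne (rowDiff G) (G i) in h
  ... | true | true | _ = symmetric , symmetric (trans ij (sym ji))
  ... | false | false | _ = symmetric , symmetric (trans ij (sym ji))
  ... | true | false | _ = forward , forward ij ji
  ... | false | true | true = backward-row , backward-row ij ji h
  ... | false | true | false = backward-col , backward-col ij ji h

  -- On colDiff G the column of j is the complement of that of i, so V = not ∘ column G i
  -- exchanges the two columns there.
  switchBy : ∀ {G k} → Case G k → Digraph n
  switchBy {G} (symmetric _) = switch G (G i j) (G j i) (G i) (not ∘ column G i)
  switchBy {G} (forward _ _) = switch G false true (raise (rowDiff G) (G i)) (not ∘ column G i)
  switchBy {G} (backward-row _ _ _) = switch G true false (lower (rowDiff G) (G i)) (not ∘ column G i)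
  switchBy {G} (backward-col _ _ _) = switch G false true (G i) (not ∘ raise (colDiff G) (column G i))

  kindOf : Bool → Bool → Bool → Kind
  kindOf true true _ = symmetric
  kindOf false false _ = symmetric
  kindOf true false _ = backward-row
  kindOf false true true = forward
  kindOf false true false = backward-col

  readKind : Digraph n → Kind
  readKind H = kindOf (H i j) (H j i) (hasUnmatchedOne (rowDiff H) (H i))

  readKind-cong : ∀ {H H′} → H ≋ H′ → readKind H ≡ readKind H′
  readKind-cong {H} {H′} H≋H′ =
    cong₂ (λ (x , y) → kindOf x y) (cong₂ _,_ (H≋H′ i j) (H≋H′ j i))
      (hasUnmatchedOne-cong rowDiff≗ (λ c _ → H≋H′ i c))
    where
    rowDiff≗ : rowDiff H ≗ rowDiff H′
    rowDiff≗ c = cong₂ (λ a b → other c ∧ (a xor b)) (H≋H′ i c) (H≋H′ j c)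

  kindOf-diag : ∀ x h → kindOf x x h ≡ symmetric
  kindOf-diag true h = refl
  kindOf-diag false h = refl

  readKind-switch : ∀ G x y W V → readKind (switch G x y W V) ≡ kindOf x y (hasUnmatchedOne (rowDiff G) W)
  readKind-switch G x y W V = cong₂ (λ (x , y) → kindOf x y)
    (cong₂ _,_ (switch-ij G x y W V) (switch-ji G x y W V))
    (hasUnmatchedOne-cong (rowDiff-switch G x y W V)
      (λ c d → switch-row-i-on G x y W V (trans (sym (rowDiff-switch G x y W V c)) d)))

  module _ {a b : Vector ℕ n} {G : Digraph n} (R : Realizes a b G) where

    private
      E D w col : Vector Bool n
      E = rowDiff G
      D = colDiff G
      w = G i
      col = column G i

    forward-raisable : b i ≤ b j → G i j ≡ true → G j i ≡ false → 0 < unmatchedZeros (rowDiff G) (G i)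
    forward-raisable bi≤bj ij ji = ones<zeros⇒0<unmatchedZeros E w (+-cancelʳ-≤ (rowRest G) _ _ (begin
      suc (ones E w) + rowRest G          ≡⟨ cong (λ z → (⟦ z ⟧ + ones E w) + rowRest G) ij ⟨
      (⟦ G i j ⟧ + ones E w) + rowRest G   ≡⟨ outdeg-i G (proj₁ R i) ⟨
      outdeg G i                         ≡⟨ proj₂ (proj₂ R i) ⟩
      b i                                ≤⟨ bi≤bj ⟩
      b j                                ≡⟨ proj₂ (proj₂ R j) ⟨
      outdeg G j                         ≡⟨ outdeg-j G (proj₁ R j) ⟩
      (⟦ G j i ⟧ + zeros E w) + rowRest G  ≡⟨ cong (λ z → (⟦ z ⟧ + zeros E w) + rowRest G) ji ⟩
      zeros E w + rowRest G               ∎))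
      where open ≤-Reasoning

    backward-raisable : a i < a j → G i j ≡ false → G j i ≡ true → 0 < unmatchedZeros (colDiff G) (column G i)
    backward-raisable ai<aj ij ji = ones<zeros⇒0<unmatchedZeros D col
      (<-trans (n<1+n _) (+-cancelʳ-< (colRest G) _ _ (begin-strict
      suc (ones D col) + colRest G          ≡⟨ cong (λ z → (⟦ z ⟧ + ones D col) + colRest G) ji ⟨
      (⟦ G j i ⟧ + ones D col) + colRest G   ≡⟨ indeg-i G (proj₁ R i) ⟨
      indeg G i                            ≡⟨ proj₁ (proj₂ R i) ⟩
      a i                                  <⟨ ai<aj ⟩
      a j                                  ≡⟨ proj₁ (proj₂ R j) ⟨
      indeg G j                            ≡⟨ indeg-j G (proj₁ R j) ⟩
      (⟦ G i j ⟧ + zeros D col) + colRest G  ≡⟨ cong (λ z → (⟦ z ⟧ + zeros D col) + colRest G) ij ⟩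
      zeros D col + colRest G               ∎)))
      where open ≤-Reasoning

    switchBy-realizes : b i ≤ b j → a i < a j → ∀ {k} (c : Case G k) → Realizes (swapAt i j a) b (switchBy c)
    switchBy-realizes _ _ (symmetric e) = switch-realizes _ _ _ _ R refl refl
      (cong (λ z → ⟦ z ⟧ + zeros D col) (sym e))
      (cong₂ (λ z s → ⟦ z ⟧ + s) e (zeros-not D col))
    switchBy-realizes bi≤bj _ (forward ij ji) = switch-realizes _ _ _ _ R
      (trans (proj₁ raised) (cong (λ z → ⟦ z ⟧ + ones E w) (sym ij)))
      (trans (proj₂ raised) (cong (λ z → ⟦ z ⟧ + zeros E w) (sym ji)))
      (cong (λ z → ⟦ z ⟧ + zeros D col) (sym ij))
      (trans (zeros-not D col) (cong (λ z → ⟦ z ⟧ + ones D col) (sym ji)))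
      where
      raised : ones E (raise E w) ≡ suc (ones E w) × suc (zeros E (raise E w)) ≡ zeros E w
      raised = raise-ones-zeros E w (forward-raisable bi≤bj ij ji)
    switchBy-realizes _ _ (backward-row ij ji h) = switch-realizes _ _ _ _ R
      (trans (proj₁ lowered) (cong (λ z → ⟦ z ⟧ + ones E w) (sym ij)))
      (trans (proj₂ lowered) (cong (λ z → ⟦ z ⟧ + zeros E w) (sym ji)))
      (cong (λ z → ⟦ z ⟧ + zeros D col) (sym ij))
      (trans (cong suc (zeros-not D col)) (cong (λ z → ⟦ z ⟧ + ones D col) (sym ji)))
      where
      lowered : suc (ones E (lower E w)) ≡ ones E w × zeros E (lower E w) ≡ suc (zeros E w)
      lowered = lower-ones-zeros E w h
    switchBy-realizes _ ai<aj (backward-col ij ji _) = switch-realizes _ _ _ _ R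
      (cong (λ z → ⟦ z ⟧ + ones E w) (sym ij))
      (cong (λ z → ⟦ z ⟧ + zeros E w) (sym ji))
      (trans (proj₂ raised) (cong (λ z → ⟦ z ⟧ + zeros D col) (sym ij)))
      (trans (zeros-not D (raise D col)) (trans (proj₁ raised) (cong (λ z → ⟦ z ⟧ + ones D col) (sym ji))))
      where
      raised : ones D (raise D col) ≡ suc (ones D col) × suc (zeros D (raise D col)) ≡ zeros D col
      raised = raise-ones-zeros D col (backward-raisable ai<aj ij ji)

    readKind-switchBy : b i ≤ b j → ∀ {k} (c : Case G k) → readKind (switchBy c) ≡ k
    readKind-switchBy _ (symmetric e) = trans (readKind-switch G _ _ _ _)
      (trans (cong (λ y → kindOf (G i j) y (hasUnmatchedOne E w)) (sym e)) (kindOf-diag (G i j) _))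
    readKind-switchBy bi≤bj (forward ij ji) =
      trans (readKind-switch G _ _ _ _) (cong (kindOf false true) (raise-hasUnmatchedOne E w (forward-raisable bi≤bj ij ji)))
    readKind-switchBy _ (backward-row _ _ _) = readKind-switch G _ _ _ _
    readKind-switchBy _ (backward-col _ _ h) = trans (readKind-switch G _ _ _ _) (cong (kindOf false true) h)

  switchBy-injective : ∀ {a b G₁ G₂ k} → Realizes a b G₁ → Realizes a b G₂ → b i ≤ b j → a i < a j →
    (c₁ : Case G₁ k) (c₂ : Case G₂ k) → switchBy c₁ ≋ switchBy c₂ → G₁ ≋ G₂
  switchBy-injective R₁ R₂ _ _ (symmetric _) (symmetric _) same =
    switch-cancel same (proj₁ R₁) (proj₁ R₂) (switch-cancel-x same) (switch-cancel-y same) (switch-cancel-W same)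
      (λ r d → not-injective (switch-cancel-V same r d))
  switchBy-injective {G₁ = G₁} {G₂} R₁ R₂ bi≤bj _ (forward ij₁ ji₁) (forward ij₂ ji₂) same =
    switch-cancel same (proj₁ R₁) (proj₁ R₂) (trans ij₁ (sym ij₂)) (trans ji₁ (sym ji₂)) row
      (λ r d → not-injective (switch-cancel-V same r d))
    where
    row : AgreeOn (rowDiff G₁) (G₁ i) (G₂ i)
    row c d = begin
      G₁ i c                                         ≡⟨ lower-raise (rowDiff G₁) (G₁ i) (forward-raisable R₁ bi≤bj ij₁ ji₁) c ⟨
      lower (rowDiff G₁) (raise (rowDiff G₁) (G₁ i)) c ≡⟨ lower-cong (switch-cancel-rowDiff same) (switch-cancel-W same) c d ⟩
      lower (rowDiff G₂) (raise (rowDiff G₂) (G₂ i)) c ≡⟨ lower-raise (rowDiff G₂) (G₂ i) (forward-raisable R₂ bi≤bj ij₂ ji₂) c ⟩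
      G₂ i c                                         ∎
      where open ≡-Reasoning
  switchBy-injective {G₁ = G₁} {G₂} R₁ R₂ _ _ (backward-row ij₁ ji₁ h₁) (backward-row ij₂ ji₂ h₂) same =
    switch-cancel same (proj₁ R₁) (proj₁ R₂) (trans ij₁ (sym ij₂)) (trans ji₁ (sym ji₂)) row
      (λ r d → not-injective (switch-cancel-V same r d))
    where
    row : AgreeOn (rowDiff G₁) (G₁ i) (G₂ i)
    row c d = begin
      G₁ i c                                         ≡⟨ raise-lower (rowDiff G₁) (G₁ i) h₁ c ⟨
      raise (rowDiff G₁) (lower (rowDiff G₁) (G₁ i)) c ≡⟨ raise-cong (switch-cancel-rowDiff same) (switch-cancel-W same) c d ⟩
      raise (rowDiff G₂) (lower (rowDiff G₂) (G₂ i)) c ≡⟨ raise-lower (rowDiff G₂) (G₂ i) h₂ c ⟩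
      G₂ i c                                         ∎
      where open ≡-Reasoning
  switchBy-injective {G₁ = G₁} {G₂} R₁ R₂ _ ai<aj (backward-col ij₁ ji₁ _) (backward-col ij₂ ji₂ _) same =
    switch-cancel same (proj₁ R₁) (proj₁ R₂) (trans ij₁ (sym ij₂)) (trans ji₁ (sym ji₂)) (switch-cancel-W same) col
    where
    col : AgreeOn (colDiff G₁) (column G₁ i) (column G₂ i)
    col r d = begin
      G₁ r i                                                       ≡⟨ lower-raise (colDiff G₁) (column G₁ i) (backward-raisable R₁ ai<aj ij₁ ji₁) r ⟨
      lower (colDiff G₁) (raise (colDiff G₁) (column G₁ i)) r        ≡⟨ lower-cong (switch-cancel-colDiff same) (λ r′ d′ → not-injective (switch-cancel-V same r′ d′)) r d ⟩
      lower (colDiff G₂) (raise (colDiff G₂) (column G₂ i)) r        ≡⟨ lower-raise (colDiff G₂) (column G₂ i) (backward-raisable R₂ ai<aj ij₂ ji₂) r ⟩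
      G₂ r i                                                       ∎
      where open ≡-Reasoning

  switchInDegrees : Digraph n → Digraph n
  switchInDegrees G = switchBy (proj₂ (caseOf G))

  module _ {a b : Vector ℕ n} (bi≤bj : b i ≤ b j) (ai<aj : a i < a j) where

    switchInDegrees-realizes : ∀ {G} → Realizes a b G → Realizes (swapAt i j a) b (switchInDegrees G)
    switchInDegrees-realizes {G} R = switchBy-realizes R bi≤bj ai<aj (proj₂ (caseOf G))

    switchInDegrees-injective : ∀ {G₁ G₂} → Realizes a b G₁ → Realizes a b G₂ →
      switchInDegrees G₁ ≋ switchInDegrees G₂ → G₁ ≋ G₂
    switchInDegrees-injective {G₁} {G₂} R₁ R₂ same with caseOf G₁ | caseOf G₂
    ... | k₁ , c₁ | k₂ , c₂
      with trans (sym (readKind-switchBy R₁ bi≤bj c₁)) (trans (readKind-cong same) (readKind-switchBy R₂ bi≤bj c₂))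
    ...   | refl = switchBy-injective R₁ R₂ bi≤bj ai<aj c₁ c₂ same

proposition10 : (n : ℕ) → (a b : Vector ℕ n) → (i j : Fin n) →
    Digraphic a b → Nondecreasing b →
    i Data.Fin.< j → a i < a j →
    Digraphic (swapAt i j a) b × N₂ (swapAt i j a) b ≥ N₂ a b
proposition10 n a b i j (G , R) b-mono i<j ai<aj =
  (switchInDegrees G , switchInDegrees-realizes bi≤bj ai<aj R) ,
  N₂-mono switchInDegrees (switchInDegrees-realizes bi≤bj ai<aj) (switchInDegrees-injective bi≤bj ai<aj)
  where
  open Switch i j (Finₚ.<⇒≢ i<j)
  bi≤bj : b i ≤ b j
  bi≤bj = b-mono i j (<⇒≤ i<j)
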